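{- For non-negative integers $m,k,s$: for any $m,s\ge1$ and $1\le k\le m/2$, $$A_{m,k,s}=\tfrac12\left(A_{m,k-1,s}+A_{m-1,k-1,s}-A_{m-1,k-1,s-1}\right).$$ Furthermore, $A_{m,k,s}=0$ for all $m,s\ge0$ and $k>m/2$; $A_{m,k,0}=1$ for all $m\ge0$ and $0\le k\le m/2$; and $A_{m,0,s}=E_{m,s}$ for all $m,s\ge0$.
   Context: $M(k_1,\ldots,k_n)$ is the multiset containing the letter $j$ exactly $k_j$ times; a permutation of it is a word in which each letter $j$ occurs exactly $k_j$ times. An ascent of a word $\pi_1\cdots\pi_m$ is an index $a$ with $\pi_a<\pi_{a+1}$. For $0\le k\le m/2$, $A_{m,k,s}$ is the number of permutations with exactly $s$ ascents of a multiset of size $m$ in which $k$ letters appear twice and $m-2k$ letters appear once (e.g. $\{1,1,2,2,\ldots,k,k,k+1,\ldots,m-k\}$; the count does not depend on which letters are doubled); for $k>m/2$ no such multiset exists. $E_{m,s}$ is the Eulerian number, the number of permutations of $\{1,\ldots,m\}$ with exactly $s$ ascents. -}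

module Defs where

open import Data.Nat using (ℕ; zero; suc; _+_; _*_; _∸_; _≤_; _<_; _≤?_; _<?_)
import Data.Nat.Properties as ℕP
open import Data.List using (List; []; _∷_; length; filter; map; concatMap; upTo)
open import Data.List.Relation.Unary.All using (All)
open import Data.List.Relation.Unary.All.Properties using ()
import Data.List.Relation.Unary.All as All
open import Data.List.Relation.Unary.Unique.Propositional using (Unique)
import Data.List.Relation.Unary.Unique.DecPropositional as UDec
open import Relation.Binary.PropositionalEquality using (_≡_)
open import Relation.Nullary using (Dec; yes; no)
open import Relation.Nullary.Decidable using (_×-dec_)
open import Data.Product using (_×_)

alphabet : ℕ → List ℕ
alphabet n = map suc (upTo n)

words : ℕ → ℕ → List (List ℕ)
words n zero = [] ∷ []
words n (suc len) = concatMap (λ a → map (a ∷_) (words n len)) (alphabet n)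

ascentsFrom : ℕ → List ℕ → ℕ
ascentsFrom x [] = 0
ascentsFrom x (y ∷ w) with x <? y
... | yes _ = suc (ascentsFrom y w)
... | no  _ = ascentsFrom y w

ascents : List ℕ → ℕ
ascents [] = 0
ascents (x ∷ w) = ascentsFrom x w

occ : ℕ → List ℕ → ℕ
occ j [] = 0
occ j (x ∷ w) with j Data.Nat.≟ x
... | yes _ = suc (occ j w)
... | no  _ = occ j w

-- multiplicity of letter j in the multiset {1,1,2,2,...,k,k,k+1,...,m-k}
mult : ℕ → ℕ → ℕ
mult k j with j ≤? k
... | yes _ = 2
... | no  _ = 1

-- w is a permutation of M(2,...,2,1,...,1) (k twos, then m-2k ones) on letters 1..m-k:
-- w uses only letters from {1..m-k} (guaranteed by `words`) and each letter j occurs mult k j times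
IsMultisetPerm : ℕ → ℕ → List ℕ → Set
IsMultisetPerm m k w = All (λ j → occ j w ≡ mult k j) (alphabet (m ∸ k))

isMultisetPerm? : ∀ m k w → Dec (IsMultisetPerm m k w)
isMultisetPerm? m k w = All.all? (λ j → occ j w Data.Nat.≟ mult k j) (alphabet (m ∸ k))

-- A_{m,k,s}: number of permutations with exactly s ascents of the multiset of size m
-- with k letters twice and m-2k letters once; 0 when k > m/2 (no such multiset).
A : ℕ → ℕ → ℕ → ℕ
A m k s with 2 * k ≤? m
... | no  _ = 0
... | yes _ = length (filter (λ w → isMultisetPerm? m k w ×-dec (ascents w Data.Nat.≟ s))
                              (words (m ∸ k) m))

-- Eulerian number E_{m,s}: permutations of {1..m} (words of length m over {1..m}
-- with no repeated letter) having exactly s ascents.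
E : ℕ → ℕ → ℕ
E m s = length (filter (λ w → UDec.unique? Data.Nat._≟_ w ×-dec (ascents w Data.Nat.≟ s))
                       (words m m))

-- Let p = k + 1. A word counted by A(m+1, k, ·) contains p and p + 1 once each; identifying p + 1
-- with p turns it into a word counted by A(m+1, k+1, ·), and every such word x arises exactly twice,
-- according to whether its first copy of p came from p + 1 or from p. In the first case the ascents
-- are unchanged; in the second there is one extra ascent exactly when the two copies of p in x are
-- adjacent. Deleting one copy of an adjacent pair is an ascent-preserving bijection onto the words
-- counted by A(m, k, ·). With N the number of x with s + 1 ascents and non-adjacent copies of p,
--   A(m+1, k+1, s+1) = A(m, k, s+1) + N   and   A(m+1, k, s+1) = (A(m, k, s) + N) + A(m+1, k+1, s+1),
-- and the recurrence follows. The only word without ascents is the weakly decreasing one, and for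
-- k = 0 the multiset permutations are the words without repeated letters.

module Submission where

open import Defs
open import Data.Nat using (ℕ; zero; suc; pred; _+_; _*_; _∸_; _≤_; _<_; z≤n; s≤s; _≤?_; _<?_; _≟_)
open import Data.Nat.Properties
open import Data.List using (List; []; _∷_; length; filter; map; concatMap; cartesianProductWith; _++_; upTo; replicate)
open import Data.List.Properties using (length-map; length-++; length-replicate; length-upTo; filter-complete; filter-≐; ∷-injective)
open import Data.List.Relation.Unary.All using (All; []; _∷_)
import Data.List.Relation.Unary.All as All
import Data.List.Relation.Unary.All.Properties as All
open import Data.List.Relation.Unary.Any using (here; there)
open import Data.List.Relation.Unary.Unique.Propositional using (Unique; []; _∷_)
import Data.List.Relation.Unary.Unique.Propositional.Properties as Unique
import Data.List.Relation.Unary.Unique.DecPropositional as UDec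
open import Data.List.Membership.Propositional using (_∈_; _∉_)
open import Data.List.Membership.Propositional.Properties
  using (∈-filter⁺; ∈-filter⁻; ∈-map⁺; ∈-map⁻; ∈-upTo⁺; ∈-upTo⁻; ∈-cartesianProductWith⁺; ∈-cartesianProductWith⁻)
open import Data.List.Membership.Propositional.Properties.WithK using (unique∧set⇒bag)
open import Data.List.Relation.Binary.BagAndSetEquality using (∼bag⇒↭)
open import Data.List.Relation.Binary.Permutation.Propositional.Properties using (↭-length)
import Data.List.Membership.DecPropositional
open import Data.Product using (_×_; _,_; proj₁; proj₂; map₂)
open import Data.Nat.Solver using (module +-*-Solver)
open import Data.Sum using (_⊎_; inj₁; inj₂; [_,_])
open import Function.Base using (_∘_; id)
open import Function.Bundles using (_⇔_; mk⇔; Equivalence)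
open import Relation.Nullary using (Dec; yes; no; ¬_; contradiction)
open import Relation.Nullary.Decidable using (_×-dec_; _⊎-dec_; ¬?; toSum)
open import Relation.Unary using (Decidable)
open import Relation.Binary.Definitions using (DecidableEquality; tri<; tri≈; tri>)
open import Relation.Binary.PropositionalEquality hiding ([_])
open import Algebra.Properties.CommutativeSemigroup +-commutativeSemigroup using (xy∙z≈xz∙y; x∙yz≈y∙xz; interchange)

-- Counting filtered lists

private variable
  S T : Set

unique∧set⇒length-≡ : {xs ys : List S} → Unique xs → Unique ys →
  (∀ {x} → x ∈ xs ⇔ x ∈ ys) → length xs ≡ length ys
unique∧set⇒length-≡ uxs uys xs⇔ys = ↭-length (∼bag⇒↭ (unique∧set⇒bag uxs uys xs⇔ys))

⊆∧length⇒⊇ : (_≟S_ : DecidableEquality S) {xs ys : List S} → Unique xs → Unique ys →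
  (∀ {x} → x ∈ xs → x ∈ ys) → length xs ≡ length ys → ∀ {y} → y ∈ ys → y ∈ xs
⊆∧length⇒⊇ _≟S_ {xs} {ys} uxs uys xs⊆ys |xs|≡|ys| y∈ys =
  proj₂ (∈-filter⁻ (_∈? xs) {xs = ys} (subst (_ ∈_) (sym ys∩xs≡ys) y∈ys))
  where
  open Data.List.Membership.DecPropositional _≟S_ using (_∈?_)
  ys∩xs≡ys : filter (_∈? xs) ys ≡ ys
  ys∩xs≡ys = filter-complete (_∈? xs) (trans
    (unique∧set⇒length-≡ (Unique.filter⁺ (_∈? xs) uys) uxs
      (mk⇔ (λ m → proj₂ (∈-filter⁻ (_∈? xs) {xs = ys} m)) (λ m → ∈-filter⁺ (_∈? xs) (xs⊆ys m) m)))
    |xs|≡|ys|)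

count-partition : {P Q : S → Set} (P? : Decidable P) (Q? : Decidable Q) (xs : List S) →
  length (filter P? xs) ≡ length (filter (λ x → P? x ×-dec Q? x) xs)
                        + length (filter (λ x → P? x ×-dec ¬? (Q? x)) xs)
count-partition P? Q? [] = refl
count-partition P? Q? (x ∷ xs) with P? x | Q? x
... | yes _ | yes _ = cong suc (count-partition P? Q? xs)
... | yes _ | no _  = trans (cong suc (count-partition P? Q? xs)) (sym (+-suc _ _))
... | no _  | yes _ = count-partition P? Q? xs
... | no _  | no _  = count-partition P? Q? xs

count-bijection : {P : S → Set} {Q : T → Set} (P? : Decidable P) (Q? : Decidable Q)
  {xs : List S} {ys : List T} → Unique xs → Unique ys →
  (f : S → T) (g : T → S) → (∀ x → g (f x) ≡ x) →
  (∀ {x} → x ∈ xs → P x → f x ∈ ys × Q (f x)) →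
  (∀ {y} → y ∈ ys → Q y → (g y ∈ xs × P (g y)) × f (g y) ≡ y) →
  length (filter P? xs) ≡ length (filter Q? ys)
count-bijection P? Q? {xs} {ys} uxs uys f g g∘f f-into g-into = trans (sym (length-map f (filter P? xs)))
  (unique∧set⇒length-≡ (Unique.map⁺ f-injective (Unique.filter⁺ P? {xs} uxs)) (Unique.filter⁺ Q? {ys} uys)
    (mk⇔ image⊆ ⊆image))
  where
  -- g ∘ f = id everywhere, not only on xs, so the image of the filtered list stays duplicate-free.
  f-injective : ∀ {x x′} → f x ≡ f x′ → x ≡ x′
  f-injective {x} {x′} e = trans (sym (g∘f x)) (trans (cong g e) (g∘f x′))
  image⊆ : ∀ {y} → y ∈ map f (filter P? xs) → y ∈ filter Q? ys
  image⊆ m with x , x∈ , refl ← ∈-map⁻ f m with x∈xs , px ← ∈-filter⁻ P? {xs = xs} x∈ =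
    let (fx∈ys , qfx) = f-into x∈xs px in ∈-filter⁺ Q? fx∈ys qfx
  ⊆image : ∀ {y} → y ∈ filter Q? ys → y ∈ map f (filter P? xs)
  ⊆image {y} m with y∈ys , qy ← ∈-filter⁻ Q? {xs = ys} m with (gy∈xs , pgy) , f∘g ← g-into y∈ys qy =
    subst (_∈ map f (filter P? xs)) f∘g (∈-map⁺ f (∈-filter⁺ P? gy∈xs pgy))

-- Words, letter counts and ascents

𝟙[_] : {P : Set} → Dec P → ℕ
𝟙[ yes _ ] = 1
𝟙[ no _ ] = 0

𝟙-yes : {P : Set} (d : Dec P) → P → 𝟙[ d ] ≡ 1
𝟙-yes (yes _) _ = refl
𝟙-yes (no ¬p) p = contradiction p ¬p

𝟙-no : {P : Set} (d : Dec P) → ¬ P → 𝟙[ d ] ≡ 0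
𝟙-no (yes p) ¬p = contradiction p ¬p
𝟙-no (no _) _ = refl

𝟙-cong : {P Q : Set} (d : Dec P) (e : Dec Q) → P ⇔ Q → 𝟙[ d ] ≡ 𝟙[ e ]
𝟙-cong (yes _) (yes _) _ = refl
𝟙-cong (yes p) (no ¬q) P⇔Q = contradiction (Equivalence.to P⇔Q p) ¬q
𝟙-cong (no ¬p) (yes q) P⇔Q = contradiction (Equivalence.from P⇔Q q) ¬p
𝟙-cong (no _) (no _) _ = refl

Letter : ℕ → ℕ → Set
Letter n a = 1 ≤ a × a ≤ n

∈-alphabet⁻ : ∀ {n a} → a ∈ alphabet n → Letter n a
∈-alphabet⁻ m with _ , i∈ , refl ← ∈-map⁻ suc m = s≤s z≤n , ∈-upTo⁻ i∈

∈-alphabet⁺ : ∀ {n a} → Letter n a → a ∈ alphabet n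
∈-alphabet⁺ {a = suc a} (_ , a<n) = ∈-map⁺ suc (∈-upTo⁺ a<n)

alphabet-unique : ∀ n → Unique (alphabet n)
alphabet-unique n = Unique.map⁺ suc-injective (Unique.upTo⁺ n)

words-suc : ∀ n ℓ → words n (suc ℓ) ≡ cartesianProductWith _∷_ (alphabet n) (words n ℓ)
words-suc n ℓ = go (alphabet n)
  where
  go : ∀ as → concatMap (λ a → map (a ∷_) (words n ℓ)) as ≡ cartesianProductWith _∷_ as (words n ℓ)
  go [] = refl
  go (a ∷ as) = cong (map (a ∷_) (words n ℓ) ++_) (go as)

∈-words⁻ : ∀ {n ℓ w} → w ∈ words n ℓ → length w ≡ ℓ × All (Letter n) w
∈-words⁻ {ℓ = zero} (here refl) = refl , []
∈-words⁻ {n} {suc ℓ} m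
  with a , w , a∈ , w∈ , refl ← ∈-cartesianProductWith⁻ _∷_ (alphabet n) (words n ℓ) (subst (_ ∈_) (words-suc n ℓ) m)
  with |w| , w-letters ← ∈-words⁻ w∈ = cong suc |w| , ∈-alphabet⁻ a∈ ∷ w-letters

∈-words⁺ : ∀ {n ℓ w} → length w ≡ ℓ → All (Letter n) w → w ∈ words n ℓ
∈-words⁺ {w = []} refl [] = here refl
∈-words⁺ {n} {suc ℓ} {a ∷ w} refl (a-letter ∷ w-letters) = subst (_ ∈_) (sym (words-suc n ℓ))
  (∈-cartesianProductWith⁺ _∷_ (∈-alphabet⁺ a-letter) (∈-words⁺ refl w-letters))

words-unique : ∀ n ℓ → Unique (words n ℓ)
words-unique n zero = [] ∷ []
words-unique n (suc ℓ) = subst Unique (sym (words-suc n ℓ))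
  (Unique.cartesianProductWith⁺ _∷_ ∷-injective (alphabet-unique n) (words-unique n ℓ))

occ-∷ : ∀ j a w → occ j (a ∷ w) ≡ 𝟙[ j ≟ a ] + occ j w
occ-∷ j a w with j ≟ a
... | yes _ = refl
... | no _ = refl

occ-here : ∀ j w → occ j (j ∷ w) ≡ suc (occ j w)
occ-here j w = trans (occ-∷ j j w) (cong (_+ occ j w) (𝟙-yes (j ≟ j) refl))

occ-there : ∀ {j a} w → j ≢ a → occ j (a ∷ w) ≡ occ j w
occ-there {j} {a} w j≢a = trans (occ-∷ j a w) (cong (_+ occ j w) (𝟙-no (j ≟ a) j≢a))

occ-++ : ∀ j u v → occ j (u ++ v) ≡ occ j u + occ j v
occ-++ j [] v = refl
occ-++ j (a ∷ u) v = begin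
  occ j (a ∷ u ++ v)             ≡⟨ occ-∷ j a (u ++ v) ⟩
  𝟙[ j ≟ a ] + occ j (u ++ v)      ≡⟨ cong (𝟙[ j ≟ a ] +_) (occ-++ j u v) ⟩
  𝟙[ j ≟ a ] + (occ j u + occ j v) ≡⟨ +-assoc 𝟙[ j ≟ a ] _ _ ⟨
  𝟙[ j ≟ a ] + occ j u + occ j v   ≡⟨ cong (_+ occ j v) (occ-∷ j a u) ⟨
  occ j (a ∷ u) + occ j v ∎
  where open ≡-Reasoning

∈⇒occ≥1 : ∀ {j w} → j ∈ w → 1 ≤ occ j w
∈⇒occ≥1 {j} {a ∷ w} (here refl) = subst (1 ≤_) (sym (occ-here j w)) (s≤s z≤n)
∈⇒occ≥1 {j} {a ∷ w} (there j∈w) = ≤-trans (∈⇒occ≥1 j∈w) (subst (occ j w ≤_) (sym (occ-∷ j a w)) (m≤n+m _ _))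

occ≥1⇒∈ : ∀ {j} w → 1 ≤ occ j w → j ∈ w
occ≥1⇒∈ {j} (a ∷ w) 1≤occ with j ≟ a
... | yes refl = here refl
... | no _ = there (occ≥1⇒∈ w 1≤occ)

occ≡0⇒∉ : ∀ {j w} → occ j w ≡ 0 → j ∉ w
occ≡0⇒∉ occ≡0 j∈w = contradiction (subst (1 ≤_) occ≡0 (∈⇒occ≥1 j∈w)) λ ()

occ-replicate-here : ∀ c a → occ a (replicate c a) ≡ c
occ-replicate-here zero a = refl
occ-replicate-here (suc c) a = trans (occ-here a (replicate c a)) (cong suc (occ-replicate-here c a))

occ-replicate-there : ∀ {i a} → i ≢ a → ∀ c → occ i (replicate c a) ≡ 0
occ-replicate-there i≢a zero = refl
occ-replicate-there i≢a (suc c) = trans (occ-there _ i≢a) (occ-replicate-there i≢a c)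

module _ (f : ℕ → ℕ) (j : ℕ) where

  occ-map-fiber₀ : (∀ a → f a ≢ j) → ∀ w → occ j (map f w) ≡ 0
  occ-map-fiber₀ no-preimage [] = refl
  occ-map-fiber₀ no-preimage (a ∷ w) =
    trans (occ-there (map f w) (λ j≡fa → no-preimage a (sym j≡fa))) (occ-map-fiber₀ no-preimage w)

  occ-map-fiber₁ : ∀ {a₀} → (∀ a → f a ≡ j → a ≡ a₀) → f a₀ ≡ j → ∀ w → occ j (map f w) ≡ occ a₀ w
  occ-map-fiber₁ fiber fa₀≡j [] = refl
  occ-map-fiber₁ {a₀} fiber fa₀≡j (a ∷ w) = begin
    occ j (f a ∷ map f w)               ≡⟨ occ-∷ j (f a) (map f w) ⟩
    𝟙[ j ≟ f a ] + occ j (map f w)      ≡⟨ cong₂ _+_ (𝟙-cong (j ≟ f a) (a₀ ≟ a) (mk⇔ (λ e → sym (fiber a (sym e)))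
                                                       (λ { refl → sym fa₀≡j })))
                                                 (occ-map-fiber₁ fiber fa₀≡j w) ⟩
    𝟙[ a₀ ≟ a ] + occ a₀ w              ≡⟨ occ-∷ a₀ a w ⟨
    occ a₀ (a ∷ w) ∎
    where open ≡-Reasoning

  occ-map-fiber₂ : ∀ {a₀ a₁} → (∀ a → f a ≡ j → a ≡ a₀ ⊎ a ≡ a₁) → f a₀ ≡ j → f a₁ ≡ j → a₀ ≢ a₁ →
    ∀ w → occ j (map f w) ≡ occ a₀ w + occ a₁ w
  occ-map-fiber₂ fiber fa₀≡j fa₁≡j a₀≢a₁ [] = refl
  occ-map-fiber₂ {a₀} {a₁} fiber fa₀≡j fa₁≡j a₀≢a₁ (a ∷ w) = begin
    occ j (f a ∷ map f w)                                ≡⟨ occ-∷ j (f a) (map f w) ⟩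
    𝟙[ j ≟ f a ] + occ j (map f w)                       ≡⟨ cong₂ _+_ head-count (occ-map-fiber₂ fiber fa₀≡j fa₁≡j a₀≢a₁ w) ⟩
    (𝟙[ a₀ ≟ a ] + 𝟙[ a₁ ≟ a ]) + (occ a₀ w + occ a₁ w) ≡⟨ interchange 𝟙[ a₀ ≟ a ] 𝟙[ a₁ ≟ a ] (occ a₀ w) (occ a₁ w) ⟩
    (𝟙[ a₀ ≟ a ] + occ a₀ w) + (𝟙[ a₁ ≟ a ] + occ a₁ w) ≡⟨ cong₂ _+_ (occ-∷ a₀ a w) (occ-∷ a₁ a w) ⟨
    occ a₀ (a ∷ w) + occ a₁ (a ∷ w) ∎
    where
    open ≡-Reasoning
    head-count : 𝟙[ j ≟ f a ] ≡ 𝟙[ a₀ ≟ a ] + 𝟙[ a₁ ≟ a ]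
    head-count with a₀ ≟ a | a₁ ≟ a
    ... | yes refl | yes refl = contradiction refl a₀≢a₁
    ... | yes refl | no _ = 𝟙-yes (j ≟ f a₀) (sym fa₀≡j)
    ... | no _ | yes refl = 𝟙-yes (j ≟ f a₁) (sym fa₁≡j)
    ... | no a₀≢a | no a₁≢a = 𝟙-no (j ≟ f a) λ j≡fa → [ (λ e → a₀≢a (sym e)) , (λ e → a₁≢a (sym e)) ] (fiber a (sym j≡fa))

ascentsFrom-∷ : ∀ a b w → ascentsFrom a (b ∷ w) ≡ 𝟙[ a <? b ] + ascentsFrom b w
ascentsFrom-∷ a b w with a <? b
... | yes _ = refl
... | no _ = refl

ascentsFrom-stutter : ∀ {a} w → ascentsFrom a (a ∷ w) ≡ ascentsFrom a w
ascentsFrom-stutter {a} w = trans (ascentsFrom-∷ a a w) (cong (_+ ascentsFrom a w) (𝟙-no (a <? a) (<-irrefl refl)))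

ascentsFrom-map : (f : ℕ → ℕ) → (∀ {a b} → a < b → f a < f b) → (∀ {a b} → f a < f b → a < b) →
  ∀ a w → ascentsFrom (f a) (map f w) ≡ ascentsFrom a w
ascentsFrom-map f mono cancel a [] = refl
ascentsFrom-map f mono cancel a (b ∷ w) = begin
  ascentsFrom (f a) (f b ∷ map f w)            ≡⟨ ascentsFrom-∷ (f a) (f b) (map f w) ⟩
  𝟙[ f a <? f b ] + ascentsFrom (f b) (map f w) ≡⟨ cong₂ _+_ (𝟙-cong (f a <? f b) (a <? b) (mk⇔ cancel mono))
                                                             (ascentsFrom-map f mono cancel b w) ⟩
  𝟙[ a <? b ] + ascentsFrom b w                 ≡⟨ ascentsFrom-∷ a b w ⟨
  ascentsFrom a (b ∷ w) ∎
  where open ≡-Reasoning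

-- Multiset permutations

mult-≤ : ∀ {k j} → j ≤ k → mult k j ≡ 2
mult-≤ {k} {j} j≤k with j ≤? k
... | yes _ = refl
... | no j≰k = contradiction j≤k j≰k

mult-> : ∀ {k j} → k < j → mult k j ≡ 1
mult-> {k} {j} k<j with j ≤? k
... | yes j≤k = contradiction j≤k (<⇒≱ k<j)
... | no _ = refl

mult-suc : ∀ k j → mult (suc k) j ≡ 𝟙[ j ≟ suc k ] + mult k j
mult-suc k j with j ≟ suc k
... | yes refl = trans (mult-≤ ≤-refl) (cong suc (sym (mult-> (n<1+n k))))
... | no j≢1+k with ≤-<-connex j k
...   | inj₁ j≤k = trans (mult-≤ (m≤n⇒m≤1+n j≤k)) (sym (mult-≤ j≤k))
...   | inj₂ k<j = trans (mult-> (≤∧≢⇒< k<j (λ e → j≢1+k (sym e)))) (sym (mult-> k<j))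

IsPerm : ℕ → ℕ → List ℕ → Set
IsPerm n k w = All (λ j → occ j w ≡ mult k j) (alphabet n)

isPerm? : ∀ n k w → Dec (IsPerm n k w)
isPerm? n k w = All.all? (λ j → occ j w ≟ mult k j) (alphabet n)

perm-lookup : ∀ {n k j} w → IsPerm n k w → Letter n j → occ j w ≡ mult k j
perm-lookup w perm j-letter = All.lookup perm (∈-alphabet⁺ j-letter)

perm-tabulate : ∀ {n k} w → (∀ {j} → Letter n j → occ j w ≡ mult k j) → IsPerm n k w
perm-tabulate w occ≡mult = All.tabulate (λ j∈ → occ≡mult (∈-alphabet⁻ j∈))

mult≥1 : ∀ k j → 1 ≤ mult k j
mult≥1 k j with j ≤? k
... | yes _ = s≤s z≤n
... | no _ = s≤s z≤n

perm-∋ : ∀ {n k j} w → IsPerm n k w → Letter n j → j ∈ w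
perm-∋ {k = k} {j = j} w perm j-letter = occ≥1⇒∈ w (subst (1 ≤_) (sym (perm-lookup w perm j-letter)) (mult≥1 k j))

permCount : (n k ℓ s : ℕ) → ℕ
permCount n k ℓ s = length (filter (λ w → isPerm? n k w ×-dec (ascents w ≟ s)) (words n ℓ))

A≡permCount : ∀ m k s → 2 * k ≤ m → A m k s ≡ permCount (m ∸ k) k m s
A≡permCount m k s 2k≤m with 2 * k ≤? m
... | yes _ = refl
... | no 2k≰m = contradiction 2k≤m 2k≰m

-- Splitting and merging the letter p

skip : ℕ → ℕ → ℕ
skip c a with a <? c
... | yes _ = a
... | no _ = suc a

skip-< : ∀ {c a} → a < c → skip c a ≡ a
skip-< {c} {a} a<c with a <? c
... | yes _ = refl
... | no a≮c = contradiction a<c a≮c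

skip-≥ : ∀ {c a} → c ≤ a → skip c a ≡ suc a
skip-≥ {c} {a} c≤a with a <? c
... | yes a<c = contradiction c≤a (<⇒≱ a<c)
... | no _ = refl

skip-≢ : ∀ c a → skip c a ≢ c
skip-≢ c a with a <? c
... | yes a<c = <⇒≢ a<c
... | no a≮c = λ 1+a≡c → a≮c (subst (a <_) 1+a≡c (n<1+n a))

skip-mono-< : ∀ c {a b} → a < b → skip c a < skip c b
skip-mono-< c {a} {b} a<b with ≤-<-connex c a | ≤-<-connex c b
... | inj₁ c≤a | inj₁ c≤b = subst₂ _<_ (sym (skip-≥ c≤a)) (sym (skip-≥ c≤b)) (s≤s a<b)
... | inj₁ c≤a | inj₂ b<c = contradiction (<-trans a<b b<c) (≤⇒≯ c≤a)
... | inj₂ a<c | inj₁ c≤b = subst₂ _<_ (sym (skip-< a<c)) (sym (skip-≥ c≤b)) (m<n⇒m<1+n a<b)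
... | inj₂ a<c | inj₂ b<c = subst₂ _<_ (sym (skip-< a<c)) (sym (skip-< b<c)) a<b

skip-cancel-< : ∀ c {a b} → skip c a < skip c b → a < b
skip-cancel-< c {a} {b} skip<skip with <-cmp a b
... | tri< a<b _ _ = a<b
... | tri≈ _ refl _ = contradiction skip<skip (<-irrefl refl)
... | tri> _ _ b<a = contradiction skip<skip (<-asym (skip-mono-< c b<a))

skip-letter : ∀ {n} c {a} → Letter n a → Letter (suc n) (skip c a)
skip-letter c {a} (1≤a , a≤n) with a <? c
... | yes _ = 1≤a , m≤n⇒m≤1+n a≤n
... | no _ = s≤s z≤n , s≤s a≤n

module Split (p : ℕ) where

  SplitLetter : ℕ → Set
  SplitLetter c = c ≡ p ⊎ c ≡ suc p

  splitLetter? : ∀ c → Dec (SplitLetter c)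
  splitLetter? c = c ≟ p ⊎-dec c ≟ suc p

  p≤splitLetter : ∀ {c} → SplitLetter c → p ≤ c
  p≤splitLetter (inj₁ refl) = ≤-refl
  p≤splitLetter (inj₂ refl) = n≤1+n p

  splitLetter≤1+p : ∀ {c} → SplitLetter c → c ≤ suc p
  splitLetter≤1+p (inj₁ refl) = n≤1+n p
  splitLetter≤1+p (inj₂ refl) = ≤-refl

  merge : ℕ → ℕ
  merge a with a ≤? p
  ... | yes _ = a
  ... | no _ = pred a

  merge-≤ : ∀ {a} → a ≤ p → merge a ≡ a
  merge-≤ {a} a≤p with a ≤? p
  ... | yes _ = refl
  ... | no a≰p = contradiction a≤p a≰p

  merge-> : ∀ {a} → p < a → merge a ≡ pred a
  merge-> {a} p<a with a ≤? p
  ... | yes a≤p = contradiction a≤p (<⇒≱ p<a)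
  ... | no _ = refl

  merge-splitLetter : ∀ {c} → SplitLetter c → merge c ≡ p
  merge-splitLetter (inj₁ refl) = merge-≤ ≤-refl
  merge-splitLetter (inj₂ refl) = merge-> (n<1+n p)

  merge≡p⇒splitLetter : ∀ {a} → merge a ≡ p → SplitLetter a
  merge≡p⇒splitLetter {a} merge≡p with a ≤? p
  ... | yes _ = inj₁ merge≡p
  merge≡p⇒splitLetter {suc a} merge≡p | no _ = inj₂ (cong suc merge≡p)
  merge≡p⇒splitLetter {zero} merge≡p | no 0≰p = contradiction z≤n 0≰p

  merge-skip : ∀ {c} → SplitLetter c → ∀ a → merge (skip c a) ≡ a
  merge-skip {c} c-split a with ≤-<-connex c a
  ... | inj₁ c≤a = trans (cong merge (skip-≥ c≤a)) (merge-> (s≤s (≤-trans (p≤splitLetter c-split) c≤a)))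
  ... | inj₂ a<c = trans (cong merge (skip-< a<c)) (merge-≤ (≤-pred (≤-trans a<c (splitLetter≤1+p c-split))))

  skip-merge : ∀ {c} → SplitLetter c → ∀ {a} → a ≢ c → skip c (merge a) ≡ a
  skip-merge {c} c-split {a} a≢c with <-cmp a p
  ... | tri< a<p _ _ = trans (cong (skip c) (merge-≤ (<⇒≤ a<p))) (skip-< (<-≤-trans a<p (p≤splitLetter c-split)))
  skip-merge (inj₁ refl) a≢p | tri≈ _ a≡p _ = contradiction a≡p a≢p
  skip-merge (inj₂ refl) _ | tri≈ _ refl _ = trans (cong (skip (suc p)) (merge-≤ ≤-refl)) (skip-< (n<1+n p))
  ... | tri> _ _ p<a with a ≟ suc p
  skip-merge (inj₁ refl) _ | tri> _ _ _ | yes refl = trans (cong (skip p) (merge-> (n<1+n p))) (skip-≥ ≤-refl)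
  skip-merge (inj₂ refl) a≢1+p | tri> _ _ _ | yes a≡1+p = contradiction a≡1+p a≢1+p
  skip-merge {c} c-split {suc a} _ | tri> _ _ p<1+a | no 1+a≢1+p =
    trans (cong (skip c) (merge-> p<1+a))
      (skip-≥ (≤-trans (splitLetter≤1+p c-split) (≤∧≢⇒< (≤-pred p<1+a) (λ p≡a → 1+a≢1+p (cong suc (sym p≡a))))))

  skip-not-splitLetter : ∀ {c} → SplitLetter c → ∀ {a} → a ≢ p → ¬ SplitLetter (skip c a)
  skip-not-splitLetter c-split {a} a≢p skip-split =
    a≢p (trans (sym (merge-skip c-split a)) (merge-splitLetter skip-split))

  private
    skip-below : ∀ {c b} → SplitLetter c → b < p → skip c b ≡ b × b < c
    skip-below c-split b<p = skip-< b<c , b<c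
      where b<c = <-≤-trans b<p (p≤splitLetter c-split)

    skip-above : ∀ {c b} → SplitLetter c → p < b → skip c b ≡ suc b × c ≤ b
    skip-above c-split p<b = skip-≥ c≤b , c≤b
      where c≤b = ≤-trans (splitLetter≤1+p c-split) p<b

  skip-<-splitLetter : ∀ {c b} → SplitLetter c → b ≢ p → skip c b < c ⇔ b < p
  skip-<-splitLetter {c} {b} c-split b≢p with <-cmp b p
  ... | tri< b<p _ _ = let (skip≡b , b<c) = skip-below c-split b<p in
    mk⇔ (λ _ → b<p) (λ _ → subst (_< c) (sym skip≡b) b<c)
  ... | tri≈ _ b≡p _ = contradiction b≡p b≢p
  ... | tri> _ _ p<b = let (skip≡1+b , c≤b) = skip-above c-split p<b in
    mk⇔ (λ skip<c → contradiction (subst (_< c) skip≡1+b skip<c) (≤⇒≯ (m≤n⇒m≤1+n c≤b)))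
        (λ b<p → contradiction b<p (<-asym p<b))

  splitLetter-<-skip : ∀ {c b} → SplitLetter c → b ≢ p → c < skip c b ⇔ p < b
  splitLetter-<-skip {c} {b} c-split b≢p with <-cmp b p
  ... | tri< b<p _ _ = let (skip≡b , b<c) = skip-below c-split b<p in
    mk⇔ (λ c<skip → contradiction (subst (c <_) skip≡b c<skip) (<-asym b<c)) (λ p<b → contradiction p<b (<-asym b<p))
  ... | tri≈ _ b≡p _ = contradiction b≡p b≢p
  ... | tri> _ _ p<b = let (skip≡1+b , c≤b) = skip-above c-split p<b in
    mk⇔ (λ _ → p<b) (λ _ → subst (c <_) (sym skip≡1+b) (s≤s c≤b))

  -- The first p becomes c and every other letter passes through skip c, which sends p to the other split letter.
  split : ℕ → List ℕ → List ℕ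
  split c [] = []
  split c (a ∷ w) with a ≟ p
  ... | yes _ = c ∷ map (skip c) w
  ... | no _ = skip c a ∷ split c w

  split-here : ∀ c w → split c (p ∷ w) ≡ c ∷ map (skip c) w
  split-here c w with p ≟ p
  ... | yes _ = refl
  ... | no p≢p = contradiction refl p≢p

  split-there : ∀ c {a} w → a ≢ p → split c (a ∷ w) ≡ skip c a ∷ split c w
  split-there c {a} w a≢p with a ≟ p
  ... | yes a≡p = contradiction a≡p a≢p
  ... | no _ = refl

  length-split : ∀ c w → length (split c w) ≡ length w
  length-split c [] = refl
  length-split c (a ∷ w) with a ≟ p
  ... | yes _ = cong suc (length-map (skip c) w)
  ... | no _ = cong suc (length-split c w)

  map-merge-skip : ∀ {c} → SplitLetter c → ∀ w → map merge (map (skip c) w) ≡ w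
  map-merge-skip c-split [] = refl
  map-merge-skip c-split (a ∷ w) = cong₂ _∷_ (merge-skip c-split a) (map-merge-skip c-split w)

  merge-split : ∀ {c} → SplitLetter c → ∀ w → map merge (split c w) ≡ w
  merge-split c-split [] = refl
  merge-split c-split (a ∷ w) with a ≟ p
  ... | yes refl = cong₂ _∷_ (merge-splitLetter c-split) (map-merge-skip c-split w)
  ... | no _ = cong₂ _∷_ (merge-skip c-split a) (merge-split c-split w)

  firstSplit : List ℕ → ℕ
  firstSplit [] = p
  firstSplit (a ∷ w) with splitLetter? a
  ... | yes _ = a
  ... | no _ = firstSplit w

  firstSplit-here : ∀ {a} → SplitLetter a → ∀ w → firstSplit (a ∷ w) ≡ a
  firstSplit-here {a} a-split w with splitLetter? a
  ... | yes _ = refl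
  ... | no ¬a-split = contradiction a-split ¬a-split

  firstSplit-there : ∀ {a} → ¬ SplitLetter a → ∀ w → firstSplit (a ∷ w) ≡ firstSplit w
  firstSplit-there {a} ¬a-split w with splitLetter? a
  ... | yes a-split = contradiction a-split ¬a-split
  ... | no _ = refl

  firstSplit-splitLetter : ∀ {y} → p ∈ y → SplitLetter (firstSplit y)
  firstSplit-splitLetter {a ∷ y} p∈ with splitLetter? a
  ... | yes a-split = a-split
  firstSplit-splitLetter {a ∷ y} (here refl) | no ¬p-split = contradiction (inj₁ refl) ¬p-split
  firstSplit-splitLetter {a ∷ y} (there p∈y) | no _ = firstSplit-splitLetter p∈y

  firstSplit-split : ∀ {c} → SplitLetter c → ∀ {w} → p ∈ w → firstSplit (split c w) ≡ c
  firstSplit-split {c} c-split {a ∷ w} p∈ with a ≟ p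
  ... | yes _ = firstSplit-here c-split (map (skip c) w)
  firstSplit-split c-split {a ∷ w} (here refl) | no a≢p = contradiction refl a≢p
  firstSplit-split {c} c-split {a ∷ w} (there p∈w) | no a≢p =
    trans (firstSplit-there (skip-not-splitLetter c-split a≢p) (split c w)) (firstSplit-split c-split p∈w)

  map-skip-merge : ∀ {c} → SplitLetter c → ∀ {w} → c ∉ w → map (skip c) (map merge w) ≡ w
  map-skip-merge c-split {[]} _ = refl
  map-skip-merge c-split {a ∷ w} c∉ =
    cong₂ _∷_ (skip-merge c-split (λ a≡c → c∉ (here (sym a≡c)))) (map-skip-merge c-split (c∉ ∘ there))

  split-merge : ∀ {c} → SplitLetter c → ∀ {y} → firstSplit y ≡ c → occ c y ≡ 1 → split c (map merge y) ≡ y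
  split-merge c-split {a ∷ y} first≡c occ≡1 with splitLetter? a
  split-merge c-split {a ∷ y} refl occ≡1 | yes a-split = begin
    split a (merge a ∷ map merge y)      ≡⟨ cong (λ b → split a (b ∷ map merge y)) (merge-splitLetter a-split) ⟩
    split a (p ∷ map merge y)            ≡⟨ split-here a (map merge y) ⟩
    a ∷ map (skip a) (map merge y)       ≡⟨ cong (a ∷_) (map-skip-merge a-split (occ≡0⇒∉ (suc-injective (trans (sym (occ-here a y)) occ≡1)))) ⟩
    a ∷ y ∎
    where open ≡-Reasoning
  split-merge {c} c-split {a ∷ y} first≡c occ≡1 | no ¬a-split = begin
    split c (merge a ∷ map merge y)      ≡⟨ split-there c (map merge y) (¬a-split ∘ merge≡p⇒splitLetter) ⟩
    skip c (merge a) ∷ split c (map merge y)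
      ≡⟨ cong₂ _∷_ (skip-merge c-split a≢c) (split-merge c-split first≡c (trans (sym (occ-there y (a≢c ∘ sym))) occ≡1)) ⟩
    a ∷ y ∎
    where
    open ≡-Reasoning
    a≢c : a ≢ c
    a≢c a≡c = ¬a-split (subst SplitLetter (sym a≡c) c-split)

  data Adjacent : List ℕ → Set where
    adjacent-head : ∀ {w} → Adjacent (p ∷ p ∷ w)
    adjacent-tail : ∀ {a w} → a ≢ p → Adjacent w → Adjacent (a ∷ w)

  adjacent? : ∀ w → Dec (Adjacent w)
  adjacent? [] = no λ ()
  adjacent? (a ∷ w) with a ≟ p
  adjacent? (a ∷ []) | yes refl = no λ { (adjacent-tail a≢p _) → a≢p refl }
  adjacent? (a ∷ b ∷ w) | yes refl with b ≟ p
  ... | yes refl = yes adjacent-head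
  ... | no b≢p = no λ { adjacent-head → b≢p refl ; (adjacent-tail p≢p _) → p≢p refl }
  adjacent? (a ∷ w) | no a≢p with adjacent? w
  ... | yes adj = yes (adjacent-tail a≢p adj)
  ... | no ¬adj = no λ { adjacent-head → a≢p refl ; (adjacent-tail _ adj) → ¬adj adj }

  adjacent-∷-head : ∀ {b w} → Adjacent (p ∷ b ∷ w) ⇔ b ≡ p
  adjacent-∷-head = mk⇔ (λ { adjacent-head → refl ; (adjacent-tail p≢p _) → contradiction refl p≢p })
                        (λ { refl → adjacent-head })

  adjacent-∷-tail : ∀ {a w} → a ≢ p → Adjacent (a ∷ w) ⇔ Adjacent w
  adjacent-∷-tail a≢p = mk⇔ (λ { adjacent-head → contradiction refl a≢p ; (adjacent-tail _ adj) → adj })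
                            (adjacent-tail a≢p)

  adjacent⇒∈ : ∀ {w} → Adjacent w → p ∈ w
  adjacent⇒∈ adjacent-head = here refl
  adjacent⇒∈ (adjacent-tail _ adj) = there (adjacent⇒∈ adj)

  extraAscent : ℕ → List ℕ → ℕ
  extraAscent c w = 𝟙[ adjacent? w ×-dec (c <? skip c p) ]

  module _ {c} (c-split : SplitLetter c) where

    private
      extra : List ℕ → ℕ
      extra = extraAscent c

    ascentsFrom-split-head : ∀ w → ascentsFrom c (map (skip c) w) ≡ ascentsFrom p w + extra (p ∷ w)
    ascentsFrom-split-head [] = sym (𝟙-no (adjacent? (p ∷ []) ×-dec _) λ { (adjacent-tail p≢p _ , _) → p≢p refl })
    ascentsFrom-split-head (b ∷ w) = begin
      ascentsFrom c (skip c b ∷ map (skip c) w)                    ≡⟨ ascentsFrom-∷ c (skip c b) _ ⟩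
      𝟙[ c <? skip c b ] + ascentsFrom (skip c b) (map (skip c) w) ≡⟨ cong₂ _+_ head-ascent
                                                                       (ascentsFrom-map (skip c) (skip-mono-< c) (skip-cancel-< c) b w) ⟩
      𝟙[ p <? b ] + extra (p ∷ b ∷ w) + ascentsFrom b w           ≡⟨ xy∙z≈xz∙y 𝟙[ p <? b ] _ _ ⟩
      𝟙[ p <? b ] + ascentsFrom b w + extra (p ∷ b ∷ w)           ≡⟨ cong (_+ extra (p ∷ b ∷ w)) (ascentsFrom-∷ p b w) ⟨
      ascentsFrom p (b ∷ w) + extra (p ∷ b ∷ w) ∎
      where
      open ≡-Reasoning
      head-ascent : 𝟙[ c <? skip c b ] ≡ 𝟙[ p <? b ] + extra (p ∷ b ∷ w)
      head-ascent with b ≟ p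
      ... | yes refl = begin
        𝟙[ c <? skip c p ]                     ≡⟨ 𝟙-cong (c <? skip c p) (adjacent? (p ∷ p ∷ w) ×-dec _) (mk⇔ (adjacent-head ,_) proj₂) ⟩
        extra (p ∷ p ∷ w)                      ≡⟨ cong (_+ extra (p ∷ p ∷ w)) (𝟙-no (p <? p) (<-irrefl refl)) ⟨
        𝟙[ p <? p ] + extra (p ∷ p ∷ w) ∎
      ... | no b≢p = begin
        𝟙[ c <? skip c b ]                     ≡⟨ 𝟙-cong (c <? skip c b) (p <? b) (splitLetter-<-skip c-split b≢p) ⟩
        𝟙[ p <? b ]                            ≡⟨ +-identityʳ _ ⟨
        𝟙[ p <? b ] + 0                        ≡⟨ cong (𝟙[ p <? b ] +_) (𝟙-no (adjacent? (p ∷ b ∷ w) ×-dec _)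
                                                    (b≢p ∘ Equivalence.to adjacent-∷-head ∘ proj₁)) ⟨
        𝟙[ p <? b ] + extra (p ∷ b ∷ w) ∎

    private
      extra-tail : ∀ {a} w → a ≢ p → extra w ≡ extra (a ∷ w)
      extra-tail {a} w a≢p = 𝟙-cong (adjacent? w ×-dec _) (adjacent? (a ∷ w) ×-dec _)
        (mk⇔ (λ (adj , c<) → Equivalence.from (adjacent-∷-tail a≢p) adj , c<)
             (λ (adj , c<) → Equivalence.to (adjacent-∷-tail a≢p) adj , c<))

    ascentsFrom-split : ∀ {b} → b ≢ p → ∀ w → ascentsFrom (skip c b) (split c w) ≡ ascentsFrom b w + extra w
    ascentsFrom-split b≢p [] = refl
    ascentsFrom-split {b} b≢p (a ∷ w) with toSum (a ≟ p)
    ... | inj₁ refl = begin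
      ascentsFrom (skip c b) (split c (p ∷ w))                     ≡⟨ cong (ascentsFrom (skip c b)) (split-here c w) ⟩
      ascentsFrom (skip c b) (c ∷ map (skip c) w)                  ≡⟨ ascentsFrom-∷ (skip c b) c _ ⟩
      𝟙[ skip c b <? c ] + ascentsFrom c (map (skip c) w)          ≡⟨ cong₂ _+_ (𝟙-cong (skip c b <? c) (b <? p) (skip-<-splitLetter c-split b≢p))
                                                                                (ascentsFrom-split-head w) ⟩
      𝟙[ b <? p ] + (ascentsFrom p w + extra (p ∷ w))              ≡⟨ +-assoc 𝟙[ b <? p ] _ _ ⟨
      𝟙[ b <? p ] + ascentsFrom p w + extra (p ∷ w)                ≡⟨ cong (_+ extra (p ∷ w)) (ascentsFrom-∷ b p w) ⟨
      ascentsFrom b (p ∷ w) + extra (p ∷ w) ∎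
      where open ≡-Reasoning
    ... | inj₂ a≢p = begin
      ascentsFrom (skip c b) (split c (a ∷ w))                     ≡⟨ cong (ascentsFrom (skip c b)) (split-there c w a≢p) ⟩
      ascentsFrom (skip c b) (skip c a ∷ split c w)                ≡⟨ ascentsFrom-∷ (skip c b) (skip c a) _ ⟩
      𝟙[ skip c b <? skip c a ] + ascentsFrom (skip c a) (split c w)
        ≡⟨ cong₂ _+_ (𝟙-cong (skip c b <? skip c a) (b <? a) (mk⇔ (skip-cancel-< c) (skip-mono-< c)))
                     (ascentsFrom-split a≢p w) ⟩
      𝟙[ b <? a ] + (ascentsFrom a w + extra w)                    ≡⟨ +-assoc 𝟙[ b <? a ] _ _ ⟨
      𝟙[ b <? a ] + ascentsFrom a w + extra w                      ≡⟨ cong₂ _+_ (ascentsFrom-∷ b a w) (sym (extra-tail w a≢p)) ⟨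
      ascentsFrom b (a ∷ w) + extra (a ∷ w) ∎
      where open ≡-Reasoning

    ascents-split : ∀ w → ascents (split c w) ≡ ascents w + extra w
    ascents-split [] = refl
    ascents-split (a ∷ w) with toSum (a ≟ p)
    ... | inj₁ refl = trans (cong ascents (split-here c w)) (ascentsFrom-split-head w)
    ... | inj₂ a≢p = trans (cong ascents (split-there c w a≢p))
                       (trans (ascentsFrom-split a≢p w) (cong (ascentsFrom a w +_) (extra-tail w a≢p)))

  ascents-split-1+p : ∀ w → ascents (split (suc p) w) ≡ ascents w
  ascents-split-1+p w = trans (ascents-split (inj₂ refl) w)
    (trans (cong (ascents w +_) (𝟙-no (adjacent? w ×-dec (suc p <? skip (suc p) p)) 1+p≮skip)) (+-identityʳ _))
    where
    1+p≮skip : ¬ (Adjacent w × suc p < skip (suc p) p)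
    1+p≮skip (_ , 1+p<skip) = <-asym (n<1+n p) (subst (suc p <_) (skip-< (n<1+n p)) 1+p<skip)

  ascents-split-p-adjacent : ∀ {w} → Adjacent w → ascents (split p w) ≡ suc (ascents w)
  ascents-split-p-adjacent {w} adj = trans (ascents-split (inj₁ refl) w)
    (trans (cong (ascents w +_) (𝟙-yes (adjacent? w ×-dec (p <? skip p p)) (adj , p<skip))) (+-comm (ascents w) 1))
    where
    p<skip : p < skip p p
    p<skip = subst (p <_) (sym (skip-≥ ≤-refl)) (n<1+n p)

  ascents-split-p-nonadjacent : ∀ {w} → ¬ Adjacent w → ascents (split p w) ≡ ascents w
  ascents-split-p-nonadjacent {w} ¬adj = trans (ascents-split (inj₁ refl) w)
    (trans (cong (ascents w +_) (𝟙-no (adjacent? w ×-dec (p <? skip p p)) (¬adj ∘ proj₁))) (+-identityʳ _))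

  removeFirst : List ℕ → List ℕ
  removeFirst [] = []
  removeFirst (a ∷ w) with a ≟ p
  ... | yes _ = w
  ... | no _ = a ∷ removeFirst w

  removeFirst-here : ∀ w → removeFirst (p ∷ w) ≡ w
  removeFirst-here w with p ≟ p
  ... | yes _ = refl
  ... | no p≢p = contradiction refl p≢p

  removeFirst-there : ∀ {a} w → a ≢ p → removeFirst (a ∷ w) ≡ a ∷ removeFirst w
  removeFirst-there {a} w a≢p with a ≟ p
  ... | yes a≡p = contradiction a≡p a≢p
  ... | no _ = refl

  double : List ℕ → List ℕ
  double [] = []
  double (a ∷ w) with a ≟ p
  ... | yes _ = a ∷ a ∷ w
  ... | no _ = a ∷ double w

  double-here : ∀ w → double (p ∷ w) ≡ p ∷ p ∷ w
  double-here w with p ≟ p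
  ... | yes _ = refl
  ... | no p≢p = contradiction refl p≢p

  double-there : ∀ {a} w → a ≢ p → double (a ∷ w) ≡ a ∷ double w
  double-there {a} w a≢p with a ≟ p
  ... | yes a≡p = contradiction a≡p a≢p
  ... | no _ = refl

  removeFirst-double : ∀ w → removeFirst (double w) ≡ w
  removeFirst-double [] = refl
  removeFirst-double (a ∷ w) with toSum (a ≟ p)
  ... | inj₁ refl = trans (cong removeFirst (double-here w)) (removeFirst-here (p ∷ w))
  ... | inj₂ a≢p = begin
    removeFirst (double (a ∷ w)) ≡⟨ cong removeFirst (double-there w a≢p) ⟩
    removeFirst (a ∷ double w)   ≡⟨ removeFirst-there (double w) a≢p ⟩
    a ∷ removeFirst (double w)   ≡⟨ cong (a ∷_) (removeFirst-double w) ⟩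
    a ∷ w ∎
    where open ≡-Reasoning

  double-removeFirst : ∀ {w} → Adjacent w → double (removeFirst w) ≡ w
  double-removeFirst (adjacent-head {w}) = trans (cong double (removeFirst-here (p ∷ w))) (double-here w)
  double-removeFirst {a ∷ w} (adjacent-tail a≢p adj) = begin
    double (removeFirst (a ∷ w)) ≡⟨ cong double (removeFirst-there w a≢p) ⟩
    double (a ∷ removeFirst w)   ≡⟨ double-there (removeFirst w) a≢p ⟩
    a ∷ double (removeFirst w)   ≡⟨ cong (a ∷_) (double-removeFirst adj) ⟩
    a ∷ w ∎
    where open ≡-Reasoning

  adjacent-double : ∀ {w} → p ∈ w → Adjacent (double w)
  adjacent-double {a ∷ w} p∈ with toSum (a ≟ p)
  ... | inj₁ refl = subst Adjacent (sym (double-here w)) adjacent-head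
  adjacent-double {a ∷ w} (here refl) | inj₂ a≢p = contradiction refl a≢p
  adjacent-double {a ∷ w} (there p∈w) | inj₂ a≢p =
    subst Adjacent (sym (double-there w a≢p)) (adjacent-tail a≢p (adjacent-double p∈w))

  occ-removeFirst : ∀ {w} → p ∈ w → ∀ j → occ j w ≡ 𝟙[ j ≟ p ] + occ j (removeFirst w)
  occ-removeFirst {a ∷ w} p∈ j with toSum (a ≟ p)
  ... | inj₁ refl = trans (occ-∷ j p w) (cong (λ v → 𝟙[ j ≟ p ] + occ j v) (sym (removeFirst-here w)))
  occ-removeFirst {a ∷ w} (here refl) j | inj₂ a≢p = contradiction refl a≢p
  occ-removeFirst {a ∷ w} (there p∈w) j | inj₂ a≢p = begin
    occ j (a ∷ w)                                          ≡⟨ occ-∷ j a w ⟩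
    𝟙[ j ≟ a ] + occ j w                                   ≡⟨ cong (𝟙[ j ≟ a ] +_) (occ-removeFirst p∈w j) ⟩
    𝟙[ j ≟ a ] + (𝟙[ j ≟ p ] + occ j (removeFirst w))      ≡⟨ x∙yz≈y∙xz 𝟙[ j ≟ a ] 𝟙[ j ≟ p ] _ ⟩
    𝟙[ j ≟ p ] + (𝟙[ j ≟ a ] + occ j (removeFirst w))      ≡⟨ cong (𝟙[ j ≟ p ] +_) (occ-∷ j a (removeFirst w)) ⟨
    𝟙[ j ≟ p ] + occ j (a ∷ removeFirst w)                 ≡⟨ cong (λ v → 𝟙[ j ≟ p ] + occ j v) (removeFirst-there w a≢p) ⟨
    𝟙[ j ≟ p ] + occ j (removeFirst (a ∷ w)) ∎
    where open ≡-Reasoning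

  length-removeFirst : ∀ {w} → p ∈ w → length w ≡ suc (length (removeFirst w))
  length-removeFirst {a ∷ w} p∈ with toSum (a ≟ p)
  ... | inj₁ refl = cong (suc ∘ length) (sym (removeFirst-here w))
  length-removeFirst {a ∷ w} (here refl) | inj₂ a≢p = contradiction refl a≢p
  length-removeFirst {a ∷ w} (there p∈w) | inj₂ a≢p =
    trans (cong suc (length-removeFirst p∈w)) (cong (suc ∘ length) (sym (removeFirst-there w a≢p)))

  ascentsFrom-double : ∀ b w → ascentsFrom b (double w) ≡ ascentsFrom b w
  ascentsFrom-double b [] = refl
  ascentsFrom-double b (a ∷ w) with toSum (a ≟ p)
  ... | inj₁ refl = begin
    ascentsFrom b (double (p ∷ w))            ≡⟨ cong (ascentsFrom b) (double-here w) ⟩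
    ascentsFrom b (p ∷ p ∷ w)                 ≡⟨ ascentsFrom-∷ b p (p ∷ w) ⟩
    𝟙[ b <? p ] + ascentsFrom p (p ∷ w)       ≡⟨ cong (𝟙[ b <? p ] +_) (ascentsFrom-stutter w) ⟩
    𝟙[ b <? p ] + ascentsFrom p w             ≡⟨ ascentsFrom-∷ b p w ⟨
    ascentsFrom b (p ∷ w) ∎
    where open ≡-Reasoning
  ... | inj₂ a≢p = begin
    ascentsFrom b (double (a ∷ w))            ≡⟨ cong (ascentsFrom b) (double-there w a≢p) ⟩
    ascentsFrom b (a ∷ double w)              ≡⟨ ascentsFrom-∷ b a (double w) ⟩
    𝟙[ b <? a ] + ascentsFrom a (double w)    ≡⟨ cong (𝟙[ b <? a ] +_) (ascentsFrom-double a w) ⟩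
    𝟙[ b <? a ] + ascentsFrom a w             ≡⟨ ascentsFrom-∷ b a w ⟨
    ascentsFrom b (a ∷ w) ∎
    where open ≡-Reasoning

  ascents-double : ∀ w → ascents (double w) ≡ ascents w
  ascents-double [] = refl
  ascents-double (a ∷ w) with toSum (a ≟ p)
  ... | inj₁ refl = trans (cong ascents (double-here w)) (ascentsFrom-stutter w)
  ... | inj₂ a≢p = trans (cong ascents (double-there w a≢p)) (ascentsFrom-double a w)

  occ-split : ∀ c {w} → p ∈ w → ∀ j → occ j (split c w) ≡ 𝟙[ j ≟ c ] + occ j (map (skip c) (removeFirst w))
  occ-split c {a ∷ w} p∈ j with toSum (a ≟ p)
  ... | inj₁ refl = begin
    occ j (split c (p ∷ w))                            ≡⟨ cong (occ j) (split-here c w) ⟩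
    occ j (c ∷ map (skip c) w)                         ≡⟨ occ-∷ j c _ ⟩
    𝟙[ j ≟ c ] + occ j (map (skip c) w)                ≡⟨ cong (λ v → 𝟙[ j ≟ c ] + occ j (map (skip c) v)) (removeFirst-here w) ⟨
    𝟙[ j ≟ c ] + occ j (map (skip c) (removeFirst (p ∷ w))) ∎
    where open ≡-Reasoning
  occ-split c {a ∷ w} (here refl) j | inj₂ a≢p = contradiction refl a≢p
  occ-split c {a ∷ w} (there p∈w) j | inj₂ a≢p = begin
    occ j (split c (a ∷ w))                                        ≡⟨ cong (occ j) (split-there c w a≢p) ⟩
    occ j (skip c a ∷ split c w)                                   ≡⟨ occ-∷ j (skip c a) _ ⟩
    𝟙[ j ≟ skip c a ] + occ j (split c w)                          ≡⟨ cong (𝟙[ j ≟ skip c a ] +_) (occ-split c p∈w j) ⟩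
    𝟙[ j ≟ skip c a ] + (𝟙[ j ≟ c ] + occ j (map (skip c) (removeFirst w)))
                                                                   ≡⟨ x∙yz≈y∙xz 𝟙[ j ≟ skip c a ] 𝟙[ j ≟ c ] _ ⟩
    𝟙[ j ≟ c ] + (𝟙[ j ≟ skip c a ] + occ j (map (skip c) (removeFirst w)))
                                                                   ≡⟨ cong (𝟙[ j ≟ c ] +_) (occ-∷ j (skip c a) _) ⟨
    𝟙[ j ≟ c ] + occ j (map (skip c) (a ∷ removeFirst w))          ≡⟨ cong (λ v → 𝟙[ j ≟ c ] + occ j (map (skip c) v))
                                                                            (removeFirst-there w a≢p) ⟨
    𝟙[ j ≟ c ] + occ j (map (skip c) (removeFirst (a ∷ w))) ∎
    where open ≡-Reasoning

  module _ {n} (p-letter : Letter n p) where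

    splitLetter-letter : ∀ {c} → SplitLetter c → Letter (suc n) c
    splitLetter-letter (inj₁ refl) = proj₁ p-letter , m≤n⇒m≤1+n (proj₂ p-letter)
    splitLetter-letter (inj₂ refl) = s≤s z≤n , s≤s (proj₂ p-letter)

    split-letters : ∀ {c} → SplitLetter c → ∀ {w} → All (Letter n) w → All (Letter (suc n)) (split c w)
    split-letters c-split [] = []
    split-letters {c} c-split {a ∷ w} (a-letter ∷ w-letters) with a ≟ p
    ... | yes _ = splitLetter-letter c-split ∷ All.map⁺ (All.map (skip-letter c) w-letters)
    ... | no _ = skip-letter c a-letter ∷ split-letters c-split w-letters

    merge-letter : ∀ {a} → Letter (suc n) a → Letter n (merge a)
    merge-letter {a} (1≤a , a≤1+n) with a ≤? p
    ... | yes a≤p = 1≤a , ≤-trans a≤p (proj₂ p-letter)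
    merge-letter {suc a} (_ , s≤s a≤n) | no 1+a≰p = ≤-trans (proj₁ p-letter) (≤-pred (≰⇒> 1+a≰p)) , a≤n

    merge-letters : ∀ {y} → All (Letter (suc n)) y → All (Letter n) (map merge y)
    merge-letters y-letters = All.map⁺ (All.map merge-letter y-letters)

    double-letters : ∀ {w} → All (Letter n) w → All (Letter n) (double w)
    double-letters [] = []
    double-letters {a ∷ w} (a-letter ∷ w-letters) with a ≟ p
    ... | yes _ = a-letter ∷ a-letter ∷ w-letters
    ... | no _ = a-letter ∷ double-letters w-letters

  removeFirst-all : {P : ℕ → Set} → ∀ {w} → All P w → All P (removeFirst w)
  removeFirst-all [] = []
  removeFirst-all {w = a ∷ w} (pa ∷ pw) with a ≟ p
  ... | yes _ = pw
  ... | no _ = pa ∷ removeFirst-all pw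

-- The recurrence

module SplitPerm (k : ℕ) where

  open Split (suc k)

  private
    p = suc k

  mult-skip : ∀ j → mult k (skip p j) ≡ mult k j
  mult-skip j with ≤-<-connex p j
  ... | inj₁ p≤j = trans (cong (mult k) (skip-≥ p≤j)) (trans (mult-> (m≤n⇒m≤1+n p≤j)) (sym (mult-> p≤j)))
  ... | inj₂ j<p = cong (mult k) (skip-< j<p)

  mult-merge : ∀ j → mult k (merge j) ≡ mult k j
  mult-merge j with ≤-<-connex j p
  ... | inj₁ j≤p = cong (mult k) (merge-≤ j≤p)
  mult-merge (suc j) | inj₂ p<1+j = trans (cong (mult k) (merge-> p<1+j)) (trans (mult-> k<j) (sym (mult-> (m<n⇒m<1+n k<j))))
    where k<j = ≤-pred p<1+j

  module _ {n} (p-letter : Letter n p) where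

    perm-split : ∀ {c} → SplitLetter c → ∀ x → IsPerm n (suc k) x → IsPerm (suc n) k (split c x)
    perm-split {c} c-split x x-perm = perm-tabulate (split c x) occ≡mult
      where
      p∈x : p ∈ x
      p∈x = perm-∋ x x-perm p-letter
      occ≡mult : ∀ {j} → Letter (suc n) j → occ j (split c x) ≡ mult k j
      occ≡mult {j} j-letter with toSum (j ≟ c)
      ... | inj₁ refl = begin
        occ c (split c x)                                  ≡⟨ occ-split c p∈x c ⟩
        𝟙[ c ≟ c ] + occ c (map (skip c) (removeFirst x))  ≡⟨ cong₂ _+_ (𝟙-yes (c ≟ c) refl) (occ-map-fiber₀ (skip c) c (skip-≢ c) (removeFirst x)) ⟩
        1                                                  ≡⟨ mult-> (p≤splitLetter c-split) ⟨
        mult k c ∎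
        where open ≡-Reasoning
      ... | inj₂ j≢c = +-cancelˡ-≡ 𝟙[ merge j ≟ p ] _ _ (begin
        𝟙[ merge j ≟ p ] + occ j (split c x)                       ≡⟨ cong (𝟙[ merge j ≟ p ] +_) (occ-split c p∈x j) ⟩
        𝟙[ merge j ≟ p ] + (𝟙[ j ≟ c ] + occ j (map (skip c) (removeFirst x)))
          ≡⟨ cong (λ e → 𝟙[ merge j ≟ p ] + (e + occ j (map (skip c) (removeFirst x)))) (𝟙-no (j ≟ c) j≢c) ⟩
        𝟙[ merge j ≟ p ] + occ j (map (skip c) (removeFirst x))
          ≡⟨ cong (𝟙[ merge j ≟ p ] +_) (occ-map-fiber₁ (skip c) j (λ a skip≡j → trans (sym (merge-skip c-split a)) (cong merge skip≡j))
                                                          (skip-merge c-split j≢c) (removeFirst x)) ⟩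
        𝟙[ merge j ≟ p ] + occ (merge j) (removeFirst x)           ≡⟨ occ-removeFirst p∈x (merge j) ⟨
        occ (merge j) x                                            ≡⟨ perm-lookup x x-perm (merge-letter p-letter j-letter) ⟩
        mult (suc k) (merge j)                                     ≡⟨ mult-suc k (merge j) ⟩
        𝟙[ merge j ≟ p ] + mult k (merge j)                        ≡⟨ cong (𝟙[ merge j ≟ p ] +_) (mult-merge j) ⟩
        𝟙[ merge j ≟ p ] + mult k j ∎)
        where open ≡-Reasoning

    perm-merge : ∀ y → IsPerm (suc n) k y → IsPerm n (suc k) (map merge y)
    perm-merge y y-perm = perm-tabulate (map merge y) occ≡mult
      where
      occ≡mult : ∀ {j} → Letter n j → occ j (map merge y) ≡ mult (suc k) j
      occ≡mult {j} (1≤j , j≤n) with toSum (j ≟ p)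
      ... | inj₁ refl = begin
        occ p (map merge y)                  ≡⟨ occ-map-fiber₂ merge p (λ _ → merge≡p⇒splitLetter) (merge-splitLetter (inj₁ refl))
                                                  (merge-splitLetter (inj₂ refl)) (<⇒≢ (n<1+n p)) y ⟩
        occ p y + occ (suc p) y              ≡⟨ cong₂ _+_ (perm-lookup y y-perm (1≤j , m≤n⇒m≤1+n j≤n))
                                                          (perm-lookup y y-perm (s≤s z≤n , s≤s j≤n)) ⟩
        mult k p + mult k (suc p)            ≡⟨ cong₂ _+_ (mult-> (n<1+n k)) (mult-> (m<n⇒m<1+n (n<1+n k))) ⟩
        2                                    ≡⟨ mult-≤ ≤-refl ⟨
        mult (suc k) p ∎
        where open ≡-Reasoning
      ... | inj₂ j≢p = begin
        occ j (map merge y)                  ≡⟨ occ-map-fiber₁ merge j merge-fiber (merge-skip (inj₁ refl) j) y ⟩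
        occ (skip p j) y                     ≡⟨ perm-lookup y y-perm (skip-letter p (1≤j , j≤n)) ⟩
        mult k (skip p j)                    ≡⟨ mult-skip j ⟩
        mult k j                             ≡⟨ cong (_+ mult k j) (𝟙-no (j ≟ p) j≢p) ⟨
        𝟙[ j ≟ p ] + mult k j                ≡⟨ mult-suc k j ⟨
        mult (suc k) j ∎
        where
        open ≡-Reasoning
        merge-fiber : ∀ a → merge a ≡ j → a ≡ skip p j
        merge-fiber a merge≡j = trans (sym (skip-merge (inj₁ refl) a≢p)) (cong (skip p) merge≡j)
          where
          a≢p : a ≢ p
          a≢p refl = j≢p (trans (sym merge≡j) (merge-splitLetter (inj₁ refl)))

  perm-removeFirst : ∀ {n x} → p ∈ x → IsPerm n (suc k) x ⇔ IsPerm n k (removeFirst x)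
  perm-removeFirst {n} {x} p∈x = mk⇔
    (λ x-perm → perm-tabulate (removeFirst x) λ {j} j-letter → +-cancelˡ-≡ 𝟙[ j ≟ p ] _ _ (begin
      𝟙[ j ≟ p ] + occ j (removeFirst x) ≡⟨ occ-removeFirst p∈x j ⟨
      occ j x                            ≡⟨ perm-lookup x x-perm j-letter ⟩
      mult (suc k) j                     ≡⟨ mult-suc k j ⟩
      𝟙[ j ≟ p ] + mult k j ∎))
    (λ rx-perm → perm-tabulate x λ {j} j-letter → begin
      occ j x                            ≡⟨ occ-removeFirst p∈x j ⟩
      𝟙[ j ≟ p ] + occ j (removeFirst x) ≡⟨ cong (𝟙[ j ≟ p ] +_) (perm-lookup (removeFirst x) rx-perm j-letter) ⟩
      𝟙[ j ≟ p ] + mult k j              ≡⟨ mult-suc k j ⟨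
      mult (suc k) j ∎)
    where open ≡-Reasoning

module Recurrence (k n ℓ : ℕ) (p≤n : suc k ≤ n) where

  open Split (suc k)
  open SplitPerm k

  private
    p = suc k

    p-letter : Letter n p
    p-letter = s≤s z≤n , p≤n

    isX? : (t : ℕ) (x : List ℕ) → Dec (IsPerm n (suc k) x × ascents x ≡ t)
    isX? t x = isPerm? n (suc k) x ×-dec (ascents x ≟ t)

    isY? : (t : ℕ) (y : List ℕ) → Dec (IsPerm (suc n) k y × ascents y ≡ t)
    isY? t y = isPerm? (suc n) k y ×-dec (ascents y ≟ t)

  count-firstSplit : ∀ {c} → SplitLetter c → ∀ t →
    length (filter (λ x → isPerm? n (suc k) x ×-dec (ascents (split c x) ≟ t)) (words n (suc ℓ)))
      ≡ length (filter (λ y → isY? t y ×-dec (firstSplit y ≟ c)) (words (suc n) (suc ℓ)))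
  count-firstSplit {c} c-split t =
    count-bijection (λ x → isPerm? n (suc k) x ×-dec (ascents (split c x) ≟ t)) (λ y → isY? t y ×-dec (firstSplit y ≟ c))
      (words-unique n (suc ℓ)) (words-unique (suc n) (suc ℓ))
      (split c) (map merge) (merge-split c-split) split-into merge-into
    where
    split-into : ∀ {x} → x ∈ words n (suc ℓ) → IsPerm n (suc k) x × ascents (split c x) ≡ t →
      split c x ∈ words (suc n) (suc ℓ) × (IsPerm (suc n) k (split c x) × ascents (split c x) ≡ t) × firstSplit (split c x) ≡ c
    split-into {x} x∈ (x-perm , asc≡t) with |x| , x-letters ← ∈-words⁻ {n} {suc ℓ} x∈ =
      ∈-words⁺ {suc n} {suc ℓ} (trans (length-split c x) |x|) (split-letters p-letter c-split x-letters) ,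
      (perm-split p-letter c-split x x-perm , asc≡t) ,
      firstSplit-split c-split (perm-∋ x x-perm p-letter)
    merge-into : ∀ {y} → y ∈ words (suc n) (suc ℓ) → (IsPerm (suc n) k y × ascents y ≡ t) × firstSplit y ≡ c →
      (map merge y ∈ words n (suc ℓ) × IsPerm n (suc k) (map merge y) × ascents (split c (map merge y)) ≡ t)
        × split c (map merge y) ≡ y
    merge-into {y} y∈ ((y-perm , asc≡t) , first≡c) with |y| , y-letters ← ∈-words⁻ {suc n} {suc ℓ} y∈ =
      (∈-words⁺ {n} {suc ℓ} (trans (length-map merge y) |y|) (merge-letters p-letter y-letters) ,
       perm-merge p-letter y y-perm , trans (cong ascents split∘merge) asc≡t) ,
      split∘merge
      where
      split∘merge : split c (map merge y) ≡ y
      split∘merge = split-merge c-split first≡c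
        (trans (perm-lookup y y-perm (splitLetter-letter p-letter c-split)) (mult-> (p≤splitLetter c-split)))

  count-double : ∀ t → permCount n k ℓ t ≡ length (filter (λ x → isX? t x ×-dec adjacent? x) (words n (suc ℓ)))
  count-double t =
    count-bijection (λ z → isPerm? n k z ×-dec (ascents z ≟ t)) (λ x → isX? t x ×-dec adjacent? x)
      (words-unique n ℓ) (words-unique n (suc ℓ)) double removeFirst removeFirst-double
      double-into removeFirst-into
    where
    double-into : ∀ {z} → z ∈ words n ℓ → IsPerm n k z × ascents z ≡ t →
      double z ∈ words n (suc ℓ) × (IsPerm n (suc k) (double z) × ascents (double z) ≡ t) × Adjacent (double z)
    double-into {z} z∈ (z-perm , asc≡t) with |z| , z-letters ← ∈-words⁻ {n} {ℓ} z∈ =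
      ∈-words⁺ {n} {suc ℓ} (trans (length-removeFirst p∈dz) (cong suc (trans (cong length (removeFirst-double z)) |z|)))
               (double-letters p-letter z-letters) ,
      (Equivalence.from (perm-removeFirst p∈dz) (subst (IsPerm n k) (sym (removeFirst-double z)) z-perm) ,
       trans (ascents-double z) asc≡t) ,
      adjacent-double p∈z
      where
      p∈z = perm-∋ z z-perm p-letter
      p∈dz = adjacent⇒∈ (adjacent-double p∈z)
    removeFirst-into : ∀ {x} → x ∈ words n (suc ℓ) → (IsPerm n (suc k) x × ascents x ≡ t) × Adjacent x →
      (removeFirst x ∈ words n ℓ × IsPerm n k (removeFirst x) × ascents (removeFirst x) ≡ t) × double (removeFirst x) ≡ x
    removeFirst-into {x} x∈ ((x-perm , asc≡t) , adj) with |x| , x-letters ← ∈-words⁻ {n} {suc ℓ} x∈ =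
      (∈-words⁺ {n} {ℓ} (suc-injective (trans (sym (length-removeFirst p∈x)) |x|)) (removeFirst-all x-letters) ,
       Equivalence.to (perm-removeFirst p∈x) x-perm ,
       trans (sym (ascents-double (removeFirst x))) (trans (cong ascents (double-removeFirst adj)) asc≡t)) ,
      double-removeFirst adj
      where
      p∈x = adjacent⇒∈ adj

  nonadjacentCount : ℕ → ℕ
  nonadjacentCount t = length (filter (λ x → isX? t x ×-dec ¬? (adjacent? x)) (words n (suc ℓ)))

  permCount-by-adjacency : ∀ t → permCount n (suc k) (suc ℓ) t ≡ permCount n k ℓ t + nonadjacentCount t
  permCount-by-adjacency t =
    trans (count-partition (isX? t) adjacent? (words n (suc ℓ))) (cong (_+ nonadjacentCount t) (sym (count-double t)))

  count-firstSplit-p : ∀ s →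
    length (filter (λ y → isY? (suc s) y ×-dec (firstSplit y ≟ p)) (words (suc n) (suc ℓ)))
      ≡ permCount n k ℓ s + nonadjacentCount (suc s)
  count-firstSplit-p s = begin
    length (filter (λ y → isY? (suc s) y ×-dec (firstSplit y ≟ p)) (words (suc n) (suc ℓ)))
      ≡⟨ count-firstSplit (inj₁ refl) (suc s) ⟨
    length (filter P? Xs)
      ≡⟨ count-partition P? adjacent? Xs ⟩
    length (filter (λ x → P? x ×-dec adjacent? x) Xs) + length (filter (λ x → P? x ×-dec ¬? (adjacent? x)) Xs)
      ≡⟨ cong₂ _+_ (trans (cong length (filter-≐ (λ x → P? x ×-dec adjacent? x) (λ x → isX? s x ×-dec adjacent? x)
                                                 (adjacent-to , adjacent-from) Xs))
                          (sym (count-double s)))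
                   (cong length (filter-≐ (λ x → P? x ×-dec ¬? (adjacent? x)) (λ x → isX? (suc s) x ×-dec ¬? (adjacent? x))
                                          (nonadjacent-to , nonadjacent-from) Xs)) ⟩
    permCount n k ℓ s + nonadjacentCount (suc s) ∎
    where
    open ≡-Reasoning
    Xs = words n (suc ℓ)
    P? : (x : List ℕ) → Dec (IsPerm n (suc k) x × ascents (split p x) ≡ suc s)
    P? x = isPerm? n (suc k) x ×-dec (ascents (split p x) ≟ suc s)
    adjacent-to : ∀ {x} → (IsPerm n (suc k) x × ascents (split p x) ≡ suc s) × Adjacent x →
      (IsPerm n (suc k) x × ascents x ≡ s) × Adjacent x
    adjacent-to ((x-perm , asc≡) , adj) = (x-perm , suc-injective (trans (sym (ascents-split-p-adjacent adj)) asc≡)) , adj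
    adjacent-from : ∀ {x} → (IsPerm n (suc k) x × ascents x ≡ s) × Adjacent x →
      (IsPerm n (suc k) x × ascents (split p x) ≡ suc s) × Adjacent x
    adjacent-from ((x-perm , asc≡) , adj) = (x-perm , trans (ascents-split-p-adjacent adj) (cong suc asc≡)) , adj
    nonadjacent-to : ∀ {x} → (IsPerm n (suc k) x × ascents (split p x) ≡ suc s) × ¬ Adjacent x →
      (IsPerm n (suc k) x × ascents x ≡ suc s) × ¬ Adjacent x
    nonadjacent-to ((x-perm , asc≡) , ¬adj) = (x-perm , trans (sym (ascents-split-p-nonadjacent ¬adj)) asc≡) , ¬adj
    nonadjacent-from : ∀ {x} → (IsPerm n (suc k) x × ascents x ≡ suc s) × ¬ Adjacent x →
      (IsPerm n (suc k) x × ascents (split p x) ≡ suc s) × ¬ Adjacent x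
    nonadjacent-from ((x-perm , asc≡) , ¬adj) = (x-perm , trans (ascents-split-p-nonadjacent ¬adj) asc≡) , ¬adj

  count-firstSplit-1+p : ∀ t →
    length (filter (λ y → isY? t y ×-dec ¬? (firstSplit y ≟ p)) (words (suc n) (suc ℓ))) ≡ permCount n (suc k) (suc ℓ) t
  count-firstSplit-1+p t = begin
    length (filter (λ y → isY? t y ×-dec ¬? (firstSplit y ≟ p)) Ys)
      ≡⟨ cong length (filter-≐ (λ y → isY? t y ×-dec ¬? (firstSplit y ≟ p)) (λ y → isY? t y ×-dec (firstSplit y ≟ suc p))
                               ((λ {y} → not-p⇒1+p {y}) , (λ {y} → 1+p⇒not-p {y})) Ys) ⟩
    length (filter (λ y → isY? t y ×-dec (firstSplit y ≟ suc p)) Ys)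
      ≡⟨ count-firstSplit (inj₂ refl) t ⟨
    length (filter (λ x → isPerm? n (suc k) x ×-dec (ascents (split (suc p) x) ≟ t)) (words n (suc ℓ)))
      ≡⟨ cong length (filter-≐ (λ x → isPerm? n (suc k) x ×-dec (ascents (split (suc p) x) ≟ t)) (isX? t)
                               ((λ {x} → map₂ (trans (sym (ascents-split-1+p x)))) , (λ {x} → map₂ (trans (ascents-split-1+p x))))
                               (words n (suc ℓ))) ⟩
    permCount n (suc k) (suc ℓ) t ∎
    where
    open ≡-Reasoning
    Ys = words (suc n) (suc ℓ)
    not-p⇒1+p : ∀ {y} → (IsPerm (suc n) k y × ascents y ≡ t) × firstSplit y ≢ p →
      (IsPerm (suc n) k y × ascents y ≡ t) × firstSplit y ≡ suc p
    not-p⇒1+p {y} ((y-perm , asc≡) , first≢p) with firstSplit-splitLetter (perm-∋ y y-perm (s≤s z≤n , m≤n⇒m≤1+n p≤n))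
    ... | inj₁ first≡p = contradiction first≡p first≢p
    ... | inj₂ first≡1+p = (y-perm , asc≡) , first≡1+p
    1+p⇒not-p : ∀ {y} → (IsPerm (suc n) k y × ascents y ≡ t) × firstSplit y ≡ suc p →
      (IsPerm (suc n) k y × ascents y ≡ t) × firstSplit y ≢ p
    1+p⇒not-p (y-is , first≡1+p) = y-is , λ first≡p → 1+n≢n (trans (sym first≡1+p) first≡p)

  recurrence : ∀ s → 2 * permCount n (suc k) (suc ℓ) (suc s) + permCount n k ℓ s
                   ≡ permCount (suc n) k (suc ℓ) (suc s) + permCount n k ℓ (suc s)
  recurrence s = begin
    2 * X + Z₀                 ≡⟨ cong (λ x → 2 * x + Z₀) (permCount-by-adjacency (suc s)) ⟩
    2 * (Z₁ + N) + Z₀          ≡⟨ solve 3 (λ z₀ z₁ n′ → con 2 :* (z₁ :+ n′) :+ z₀ := (z₀ :+ n′) :+ (z₁ :+ n′) :+ z₁) refl Z₀ Z₁ N ⟩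
    (Z₀ + N) + (Z₁ + N) + Z₁   ≡⟨ cong (_+ Z₁) Y≡ ⟨
    Y + Z₁ ∎
    where
    open ≡-Reasoning
    open +-*-Solver
    X = permCount n (suc k) (suc ℓ) (suc s)
    Y = permCount (suc n) k (suc ℓ) (suc s)
    Z₀ = permCount n k ℓ s
    Z₁ = permCount n k ℓ (suc s)
    N = nonadjacentCount (suc s)
    Y≡ : Y ≡ (Z₀ + N) + (Z₁ + N)
    Y≡ = trans (count-partition (isY? (suc s)) (λ y → firstSplit y ≟ p) (words (suc n) (suc ℓ)))
               (cong₂ _+_ (count-firstSplit-p s) (trans (count-firstSplit-1+p (suc s)) (permCount-by-adjacency (suc s))))

-- Words without ascents

ascentsFrom≡0⇒bounded : ∀ a w → ascentsFrom a w ≡ 0 → All (_≤ a) w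
ascentsFrom≡0⇒bounded a [] _ = []
ascentsFrom≡0⇒bounded a (b ∷ w) asc≡0 = b≤a ∷ All.map (λ c≤b → ≤-trans c≤b b≤a) (ascentsFrom≡0⇒bounded b w tail≡0)
  where
  split≡0 = trans (sym (ascentsFrom-∷ a b w)) asc≡0
  tail≡0 = m+n≡0⇒n≡0 𝟙[ a <? b ] split≡0
  b≤a : b ≤ a
  b≤a = ≮⇒≥ λ a<b → contradiction (trans (sym (cong (_+ ascentsFrom b w) (𝟙-yes (a <? b) a<b))) split≡0) λ ()

ascentsFrom≡0⇒ascents≡0 : ∀ a w → ascentsFrom a w ≡ 0 → ascents w ≡ 0
ascentsFrom≡0⇒ascents≡0 a [] _ = refl
ascentsFrom≡0⇒ascents≡0 a (b ∷ w) asc≡0 = m+n≡0⇒n≡0 𝟙[ a <? b ] (trans (sym (ascentsFrom-∷ a b w)) asc≡0)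

occ-bounded : ∀ {a j w} → All (_≤ a) w → a < j → occ j w ≡ 0
occ-bounded [] _ = refl
occ-bounded {w = b ∷ w} (b≤a ∷ w≤a) a<j = trans (occ-there w (λ j≡b → <⇒≱ a<j (subst (_≤ _) (sym j≡b) b≤a))) (occ-bounded w≤a a<j)

no-ascents-unique : ∀ {u v} → ascents u ≡ 0 → ascents v ≡ 0 → (∀ j → occ j u ≡ occ j v) → u ≡ v
no-ascents-unique {[]} {[]} _ _ _ = refl
no-ascents-unique {[]} {b ∷ v} _ _ same-occ = contradiction (trans (same-occ b) (occ-here b v)) λ ()
no-ascents-unique {a ∷ u} {[]} _ _ same-occ = contradiction (trans (sym (same-occ a)) (occ-here a u)) λ ()
no-ascents-unique {a ∷ u} {b ∷ v} u-asc v-asc same-occ with <-cmp a b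
... | tri< a<b _ _ = contradiction (trans (sym (occ-bounded (≤-refl ∷ ascentsFrom≡0⇒bounded a u u-asc) a<b)) (trans (same-occ b) (occ-here b v))) λ ()
... | tri> _ _ b<a = contradiction (trans (sym (occ-bounded (≤-refl ∷ ascentsFrom≡0⇒bounded b v v-asc) b<a)) (trans (sym (same-occ a)) (occ-here a u))) λ ()
... | tri≈ _ refl _ = cong (a ∷_) (no-ascents-unique (ascentsFrom≡0⇒ascents≡0 a u u-asc) (ascentsFrom≡0⇒ascents≡0 a v v-asc)
    λ j → +-cancelˡ-≡ 𝟙[ j ≟ a ] _ _ (trans (sym (occ-∷ j a u)) (trans (same-occ j) (occ-∷ j a v))))

letters⇒occ≡0 : ∀ {n j w} → All (Letter n) w → ¬ Letter n j → occ j w ≡ 0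
letters⇒occ≡0 [] _ = refl
letters⇒occ≡0 {w = b ∷ w} (b-letter ∷ w-letters) ¬j-letter =
  trans (occ-there w (λ { refl → ¬j-letter b-letter })) (letters⇒occ≡0 w-letters ¬j-letter)

letter? : ∀ n j → Dec (Letter n j)
letter? n j = (1 ≤? j) ×-dec (j ≤? n)

decreasingWord : ℕ → ℕ → List ℕ
decreasingWord k zero = []
decreasingWord k (suc j) = replicate (mult k (suc j)) (suc j) ++ decreasingWord k j

module _ (k : ℕ) where

  length-decreasingWord-≤ : ∀ {j} → j ≤ k → length (decreasingWord k j) ≡ j + j
  length-decreasingWord-≤ {zero} _ = refl
  length-decreasingWord-≤ {suc j} 1+j≤k = begin
    length (replicate (mult k (suc j)) (suc j) ++ decreasingWord k j)  ≡⟨ length-++ (replicate (mult k (suc j)) (suc j)) ⟩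
    length (replicate (mult k (suc j)) (suc j)) + length (decreasingWord k j)
      ≡⟨ cong₂ _+_ (trans (length-replicate (mult k (suc j))) (mult-≤ 1+j≤k)) (length-decreasingWord-≤ (<⇒≤ 1+j≤k)) ⟩
    2 + (j + j)                                                       ≡⟨ cong suc (+-suc j j) ⟨
    suc j + suc j ∎
    where open ≡-Reasoning

  length-decreasingWord : ∀ {j} → k ≤ j → length (decreasingWord k j) ≡ j + k
  length-decreasingWord k≤j with m≤n⇒m<n∨m≡n k≤j
  ... | inj₂ refl = length-decreasingWord-≤ ≤-refl
  length-decreasingWord {suc j} _ | inj₁ k<1+j = begin
    length (replicate (mult k (suc j)) (suc j) ++ decreasingWord k j)  ≡⟨ length-++ (replicate (mult k (suc j)) (suc j)) ⟩
    length (replicate (mult k (suc j)) (suc j)) + length (decreasingWord k j)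
      ≡⟨ cong₂ _+_ (trans (length-replicate (mult k (suc j))) (mult-> k<1+j)) (length-decreasingWord (≤-pred k<1+j)) ⟩
    suc (j + k) ∎
    where open ≡-Reasoning

  decreasingWord-letters : ∀ {n j} → j ≤ n → All (Letter n) (decreasingWord k j)
  decreasingWord-letters {j = zero} _ = []
  decreasingWord-letters {j = suc j} 1+j≤n =
    All.++⁺ (All.replicate⁺ (mult k (suc j)) (s≤s z≤n , 1+j≤n)) (decreasingWord-letters (<⇒≤ 1+j≤n))

  occ-decreasingWord-> : ∀ {i j} → j < i → occ i (decreasingWord k j) ≡ 0
  occ-decreasingWord-> j<i = letters⇒occ≡0 (decreasingWord-letters ≤-refl) (λ (_ , i≤j) → <⇒≱ j<i i≤j)

  occ-decreasingWord : ∀ {i j} → Letter j i → occ i (decreasingWord k j) ≡ mult k i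
  occ-decreasingWord {j = zero} (1≤i , i≤0) = contradiction (≤-trans 1≤i i≤0) λ ()
  occ-decreasingWord {i} {suc j} (1≤i , i≤1+j) = trans (occ-++ i (replicate (mult k (suc j)) (suc j)) _) (go (toSum (i ≟ suc j)))
    where
    go : i ≡ suc j ⊎ i ≢ suc j → occ i (replicate (mult k (suc j)) (suc j)) + occ i (decreasingWord k j) ≡ mult k i
    go (inj₁ refl) = trans (cong₂ _+_ (occ-replicate-here (mult k i) i) (occ-decreasingWord-> (n<1+n j))) (+-identityʳ _)
    go (inj₂ i≢1+j) = cong₂ _+_ (occ-replicate-there i≢1+j (mult k (suc j))) (occ-decreasingWord (1≤i , ≤-pred (≤∧≢⇒< i≤1+j i≢1+j)))

  ascentsFrom-decreasingWord : ∀ j {b} → j ≤ b → ascentsFrom b (decreasingWord k j) ≡ 0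
  ascentsFrom-decreasingWord zero _ = refl
  ascentsFrom-decreasingWord (suc j) = no-ascents-replicate (mult k (suc j))
    where
    no-ascents-replicate : ∀ c {b} → suc j ≤ b → ascentsFrom b (replicate c (suc j) ++ decreasingWord k j) ≡ 0
    no-ascents-replicate zero 1+j≤b = ascentsFrom-decreasingWord j (<⇒≤ 1+j≤b)
    no-ascents-replicate (suc c) {b} 1+j≤b = trans (ascentsFrom-∷ b (suc j) _)
      (cong₂ _+_ (𝟙-no (b <? suc j) (≤⇒≯ 1+j≤b)) (no-ascents-replicate c ≤-refl))

permCount-no-ascents : ∀ {n k ℓ} → k ≤ n → ℓ ≡ n + k → permCount n k ℓ 0 ≡ 1
permCount-no-ascents {n} {k} {ℓ} k≤n ℓ≡n+k =
  unique∧set⇒length-≡ (Unique.filter⁺ P? (words-unique n ℓ)) ([] ∷ []) (mk⇔ only-w₀ w₀-counted)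
  where
  P? : (w : List ℕ) → Dec (IsPerm n k w × ascents w ≡ 0)
  P? w = isPerm? n k w ×-dec (ascents w ≟ 0)
  w₀ = decreasingWord k n
  w₀-letters = decreasingWord-letters k ≤-refl
  w₀-perm : IsPerm n k w₀
  w₀-perm = perm-tabulate w₀ (occ-decreasingWord k)
  w₀-asc : ascents w₀ ≡ 0
  w₀-asc = ascentsFrom≡0⇒ascents≡0 n w₀ (ascentsFrom-decreasingWord k n ≤-refl)
  only-w₀ : ∀ {w} → w ∈ filter P? (words n ℓ) → w ∈ w₀ ∷ []
  only-w₀ {w} w∈ with w∈words , w-perm , w-asc ← ∈-filter⁻ P? {xs = words n ℓ} w∈ =
    here (no-ascents-unique w-asc w₀-asc same-occ)
    where
    same-occ : ∀ j → occ j w ≡ occ j w₀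
    same-occ j with letter? n j
    ... | yes j-letter = trans (perm-lookup w w-perm j-letter) (sym (perm-lookup w₀ w₀-perm j-letter))
    ... | no ¬j-letter = trans (letters⇒occ≡0 (proj₂ (∈-words⁻ {n} {ℓ} w∈words)) ¬j-letter) (sym (letters⇒occ≡0 w₀-letters ¬j-letter))
  w₀-counted : ∀ {w} → w ∈ w₀ ∷ [] → w ∈ filter P? (words n ℓ)
  w₀-counted (here refl) = ∈-filter⁺ P? (∈-words⁺ {n} {ℓ} (trans (length-decreasingWord k k≤n) (sym ℓ≡n+k)) w₀-letters) (w₀-perm , w₀-asc)

-- Eulerian numbers

∉⇒occ≡0 : ∀ {j} w → j ∉ w → occ j w ≡ 0
∉⇒occ≡0 {j} w j∉w with occ j w in occ≡
... | zero = refl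
... | suc _ = contradiction (occ≥1⇒∈ w (subst (1 ≤_) (sym occ≡) (s≤s z≤n))) j∉w

unique⇒occ≤1 : ∀ {w} → Unique w → ∀ j → occ j w ≤ 1
unique⇒occ≤1 [] j = z≤n
unique⇒occ≤1 {a ∷ w} (a∉w ∷ w-unique) j with toSum (j ≟ a)
... | inj₁ refl = ≤-reflexive (trans (occ-here j w) (cong suc (∉⇒occ≡0 w (All.All¬⇒¬Any a∉w))))
... | inj₂ j≢a = subst (_≤ 1) (sym (occ-there w j≢a)) (unique⇒occ≤1 w-unique j)

occ≤1⇒unique : ∀ w → (∀ j → occ j w ≤ 1) → Unique w
occ≤1⇒unique [] _ = []
occ≤1⇒unique (a ∷ w) occ≤1 = All.tabulate a∉w ∷ occ≤1⇒unique w tail-occ≤1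
  where
  tail-occ≤1 : ∀ j → occ j w ≤ 1
  tail-occ≤1 j = ≤-trans (subst (occ j w ≤_) (sym (occ-∷ j a w)) (m≤n+m _ _)) (occ≤1 j)
  a∉w : ∀ {b} → b ∈ w → a ≢ b
  a∉w b∈w refl = contradiction (subst (_≤ 1) (occ-here a w) (occ≤1 a)) (<⇒≱ (s≤s (∈⇒occ≥1 b∈w)))

length-alphabet : ∀ n → length (alphabet n) ≡ n
length-alphabet n = trans (length-map suc (upTo n)) (length-upTo n)

perm₀⇒unique : ∀ {n w} → All (Letter n) w → IsPerm n 0 w → Unique w
perm₀⇒unique {n} {w} w-letters w-perm = occ≤1⇒unique w occ≤1
  where
  occ≤1 : ∀ j → occ j w ≤ 1
  occ≤1 j with letter? n j
  ... | yes j-letter = ≤-reflexive (trans (perm-lookup w w-perm j-letter) (mult-> (proj₁ j-letter)))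
  ... | no ¬j-letter = subst (_≤ 1) (sym (letters⇒occ≡0 w-letters ¬j-letter)) z≤n

unique⇒perm₀ : ∀ {n w} → length w ≡ n → All (Letter n) w → Unique w → IsPerm n 0 w
unique⇒perm₀ {n} {w} |w|≡n w-letters w-unique = perm-tabulate w λ {j} j-letter →
  trans (≤-antisym (unique⇒occ≤1 w-unique j) (∈⇒occ≥1 (letter∈w j-letter))) (sym (mult-> (proj₁ j-letter)))
  where
  letter∈w : ∀ {j} → Letter n j → j ∈ w
  letter∈w j-letter = ⊆∧length⇒⊇ _≟_ w-unique (alphabet-unique n) (∈-alphabet⁺ ∘ All.lookup w-letters)
    (trans |w|≡n (sym (length-alphabet n))) (∈-alphabet⁺ j-letter)

permCount≡E : ∀ m s → permCount m 0 m s ≡ E m s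
permCount≡E m s = count-bijection (λ w → isPerm? m 0 w ×-dec (ascents w ≟ s)) (λ w → UDec.unique? _≟_ w ×-dec (ascents w ≟ s))
  (words-unique m m) (words-unique m m) id id (λ _ → refl)
  (λ {w} w∈ (w-perm , asc≡s) → w∈ , perm₀⇒unique (proj₂ (∈-words⁻ {m} {m} w∈)) w-perm , asc≡s)
  (λ {w} w∈ (w-unique , asc≡s) → let (|w| , w-letters) = ∈-words⁻ {m} {m} w∈ in
    (w∈ , unique⇒perm₀ |w| w-letters w-unique , asc≡s) , refl)

A-recurrence : ∀ m k s → 2 * suc k ≤ suc m →
  2 * A (suc m) (suc k) (suc s) + A m k s ≡ A (suc m) k (suc s) + A m k (suc s)
A-recurrence m k s 2[1+k]≤1+m = begin
  2 * A (suc m) (suc k) (suc s) + A m k s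
    ≡⟨ cong₂ (λ a b → 2 * a + b) (A≡permCount (suc m) (suc k) (suc s) 2[1+k]≤1+m) (A≡permCount m k s 2k≤m) ⟩
  2 * permCount (m ∸ k) (suc k) (suc m) (suc s) + permCount (m ∸ k) k m s
    ≡⟨ Recurrence.recurrence k (m ∸ k) m 1+k≤m∸k s ⟩
  permCount (suc (m ∸ k)) k (suc m) (suc s) + permCount (m ∸ k) k m (suc s)
    ≡⟨ cong₂ _+_ (trans (cong (λ n → permCount n k (suc m) (suc s)) (sym (+-∸-assoc 1 k≤m)))
                        (sym (A≡permCount (suc m) k (suc s) (m≤n⇒m≤1+n 2k≤m))))
                 (sym (A≡permCount m k (suc s) 2k≤m)) ⟩
  A (suc m) k (suc s) + A m k (suc s) ∎
  where
  open ≡-Reasoning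
  k+1+k≤m : k + suc k ≤ m
  k+1+k≤m = subst (_≤ m) (cong (k +_) (cong suc (+-identityʳ k))) (≤-pred 2[1+k]≤1+m)
  2k≤m : 2 * k ≤ m
  2k≤m = ≤-trans (≤-reflexive (cong (k +_) (+-identityʳ k))) (≤-trans (+-monoʳ-≤ k (n≤1+n k)) k+1+k≤m)
  k≤m : k ≤ m
  k≤m = m+n≤o⇒m≤o k k+1+k≤m
  1+k≤m∸k : suc k ≤ m ∸ k
  1+k≤m∸k = m+n≤o⇒m≤o∸n (suc k) (subst (_≤ m) (+-comm k (suc k)) k+1+k≤m)

A≡0 : ∀ m k s → m < 2 * k → A m k s ≡ 0
A≡0 m k s m<2k with 2 * k ≤? m
... | yes 2k≤m = contradiction 2k≤m (<⇒≱ m<2k)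
... | no _ = refl

A-no-ascents : ∀ m k → 2 * k ≤ m → A m k 0 ≡ 1
A-no-ascents m k 2k≤m = trans (A≡permCount m k 0 2k≤m) (permCount-no-ascents k≤m∸k (sym (m∸n+n≡m k≤m)))
  where
  k+k≤m : k + k ≤ m
  k+k≤m = subst (_≤ m) (cong (k +_) (+-identityʳ k)) 2k≤m
  k≤m : k ≤ m
  k≤m = m+n≤o⇒m≤o k k+k≤m
  k≤m∸k : k ≤ m ∸ k
  k≤m∸k = m+n≤o⇒m≤o∸n k k+k≤m

A≡E : ∀ m s → A m 0 s ≡ E m s
A≡E m s = trans (A≡permCount m 0 s z≤n) (permCount≡E m s)

theorem5p2 :
    (∀ m k s → 2 * suc k ≤ suc m →
      2 * A (suc m) (suc k) (suc s) + A m k s ≡ A (suc m) k (suc s) + A m k (suc s))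
    × (∀ m k s → m < 2 * k → A m k s ≡ 0)
    × (∀ m k → 2 * k ≤ m → A m k 0 ≡ 1)
    × (∀ m s → A m 0 s ≡ E m s)
theorem5p2 = A-recurrence , A≡0 , A-no-ascents , A≡E
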